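{- Let $a$ be a nonnegative integer with binary expansion $a=\sum_{n\ge 0} a_n 2^n$, $a_n\in\{0,1\}$ (so $a_n=0$ for all large $n$). Let $S$ be the left shift on $l^1(\mathbb{Z})$, $(Su)(d)=u(d+1)$, let $Id$ be the identity operator and $\delta_0\in l^1(\mathbb{Z})$ the Dirac mass at $0$. Define the $2\times 2$ matrices of operators on $l^1(\mathbb{Z})$ $$A_0=\begin{pmatrix} Id & \tfrac12 S^{ -1}\\ 0 & \tfrac12 S\end{pmatrix},\qquad A_1=\begin{pmatrix} \tfrac12 S^{ -1} & 0\\ \tfrac12 S & Id\end{pmatrix},$$ acting on column vectors in $l^1(\mathbb{Z})^2$. Then $\mu_a$ is given by the infinite product $$\mu_a=(Id,\;Id)\cdots A_{a_n}A_{a_{n-1}}\cdots A_{a_1}A_{a_0}\begin{pmatrix}\delta_0\\0\end{pmatrix},$$ in the sense that for every $d\in\mathbb{Z}$, $$\mu_a(d)=\lim_{n\to\infty}\Big((Id,\;Id)\,A_{a_n}A_{a_{n-1}}\cdots A_{a_0}\begin{pmatrix}\delta_0\\0\end{pmatrix}\Big)(d).$$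
   Context: For $x\in\mathbb{N}$ with binary expansion $x=\sum_k x_k2^k$, $s_2(x)=\sum_k x_k$ is the number of digits $1$. For $a\in\mathbb{N}$ and $d\in\mathbb{Z}$, $\mu_a(d)=\lim_{N\to\infty}\frac1N\#\{x\in\mathbb{N}: x\le N,\ s_2(x+a)-s_2(x)=d\}$ (this limit exists); $\mu_a$ is a probability measure on $\mathbb{Z}$, identified with an element of $l^1(\mathbb{Z})$. $(Id,Id)$ maps a column vector $(u,v)^T$ to $u+v$. -}

module Defs where

open import Data.Nat using (ℕ; zero; suc; _/_; _%_)
open import Data.Integer as ℤ using (ℤ; +_)
open import Data.Rational as ℚ using (ℚ; 0ℚ; 1ℚ; ½)
open import Data.List using (List; map; upTo; filter; length)
open import Data.Nat.ListAction using (sum)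
open import Data.Product using (_×_; _,_; proj₁; proj₂)
open import Relation.Nullary using (does)

shiftR : ℕ → ℕ → ℕ
shiftR zero    x = x
shiftR (suc k) x = shiftR k (x / 2)

bit : ℕ → ℕ → ℕ
bit k x = shiftR k x % 2

-- s₂(x) = Σ_k x_k ; digits x_k vanish for k > x since x < 2^(x+1)
s₂ : ℕ → ℕ
s₂ x = sum (map (λ k → bit k x) (upTo (suc x)))

Δ : ℕ → ℕ → ℤ
Δ a x = + s₂ (x Data.Nat.+ a) ℤ.- + s₂ x

count : ℕ → ℤ → ℕ → ℕ
count a d N = length (filter (λ x → Δ a x ℤ.≟ d) (upTo (suc N)))

-- (1/N) #{x ≤ N : ...}, evaluated at N = suc m (N ≥ 1)
density : ℕ → ℤ → ℕ → ℚ
density a d m = (+ count a d (suc m)) ℚ./ suc m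

-- elements of l¹(ℤ) that occur here are finitely supported; represented pointwise
L : Set
L = ℤ → ℚ

δ₀ : L
δ₀ d = if does (d ℤ.≟ + 0) then 1ℚ else 0ℚ
  where open import Data.Bool using (if_then_else_)

zeroL : L
zeroL _ = 0ℚ

S : L → L
S u d = u (d ℤ.+ + 1)

S⁻¹ : L → L
S⁻¹ u d = u (d ℤ.- + 1)

A : ℕ → L × L → L × L
A zero    (u , v) = (λ d → u d ℚ.+ ½ ℚ.* S⁻¹ v d) , (λ d → ½ ℚ.* S v d)
A (suc _) (u , v) = (λ d → ½ ℚ.* S⁻¹ u d) , (λ d → ½ ℚ.* S u d ℚ.+ v d)

prodVec : ℕ → ℕ → L × L
prodVec a zero    = A (bit 0 a) (δ₀ , zeroL)
prodVec a (suc n) = A (bit (suc n) a) (prodVec a n)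

prodSeq : ℕ → ℕ → ℤ → ℚ
prodSeq a n d = proj₁ (prodVec a n) d ℚ.+ proj₂ (prodVec a n) d

module Submission where

-- Write r_k(x) for the state after adding the k lowest binary columns of x + a:
-- the accumulated change of the digit sum together with the outgoing carry (0 or 1).
-- Processing one more column is a local rule depending only on the digit a_k, the
-- digit x_k and the carry, and it is 2^k-periodic in x.  Counting the residues
-- r < 2^k by their state gives two count functions, and adding the top column shows
-- that the normalised counts obey exactly the recursion of the matrices A_0, A_1;
-- hence the k-fold product applied to (δ₀, 0) is (counts / 2^k) (`product-counts`).
--
-- Once 2^k > a, a residue without carry out of column k already has its final
-- digit-sum change.  Hence the empirical density of {x : s₂(x+a) − s₂(x) = d} and
-- the product sequence both differ from g / 2^k, g the number of residues in state
-- (d, no carry), by at most the proportion of carrying residues plus boundary terms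
-- (`count-approx`, `stateTotal-approx`).  The number of carrying residues stops
-- changing once 2^k > a, so their proportion at level k = a + t is at most 2^-t;
-- choosing t and then m, n large makes both errors small.

open import Defs
open import Data.Bool using (Bool; true; false; if_then_else_)
open import Data.Empty using (⊥-elim)
open import Data.Integer as ℤ using (ℤ; _⊖_)
import Data.Integer.Properties as ℤP
open import Algebra.Properties.AbelianGroup ℤP.+-0-abelianGroup using (∙-cancelʳ)
import Data.Integer.Solver
open import Data.List using (applyUpTo; filter; length)
open import Data.List.Properties using (map-upTo)
open import Data.Nat as ℕ using (ℕ; zero; suc; _+_; _*_; _^_; _≤_; _<_; _/_; _%_; _∸_; z≤n; s≤s)
open import Data.Nat.DivMod
open import Data.Nat.Divisibility using (divides)
open import Data.Nat.ListAction using (sum)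
open import Data.Nat.Properties
import Data.Nat.Solver
open import Data.Product using (_×_; _,_; proj₁; proj₂; ∃-syntax)
open import Data.Rational as ℚ using (ℚ; mkℚ; ½; 0ℚ; toℚᵘ)
import Data.Rational.Properties as ℚP
open import Data.Rational.Unnormalised as ℚᵘ using (mkℚᵘ; *≡*; *<*)
import Data.Rational.Unnormalised.Properties as ℚᵘP
open import Data.Sum using (inj₁; inj₂)
open import Relation.Binary.PropositionalEquality
open import Relation.Nullary using (does; yes; no; Dec)
open import Relation.Nullary.Negation using (contradiction)

open Data.Nat.Solver.+-*-Solver using (solve; _:=_; _:+_; _:*_; con)
module ZS = Data.Integer.Solver.+-*-Solver

sumTo : ℕ → (ℕ → ℕ) → ℕ
sumTo zero    f = 0
sumTo (suc n) f = f 0 + sumTo n (λ i → f (suc i))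

sum-applyUpTo : ∀ n (f : ℕ → ℕ) → sum (applyUpTo f n) ≡ sumTo n f
sum-applyUpTo zero    f = refl
sum-applyUpTo (suc n) f = cong (f 0 +_) (sum-applyUpTo n (λ i → f (suc i)))

sumTo-cong : ∀ n {f g : ℕ → ℕ} → (∀ i → i < n → f i ≡ g i) → sumTo n f ≡ sumTo n g
sumTo-cong zero    eq = refl
sumTo-cong (suc n) eq = cong₂ _+_ (eq 0 (s≤s z≤n)) (sumTo-cong n (λ i i<n → eq (suc i) (s≤s i<n)))

sumTo-+ : ∀ n (f g : ℕ → ℕ) → sumTo n (λ i → f i + g i) ≡ sumTo n f + sumTo n g
sumTo-+ zero    f g = refl
sumTo-+ (suc n) f g = begin
  (f 0 + g 0) + sumTo n (λ i → f (suc i) + g (suc i))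
    ≡⟨ cong (f 0 + g 0 +_) (sumTo-+ n (λ i → f (suc i)) (λ i → g (suc i))) ⟩
  (f 0 + g 0) + (sumTo n (λ i → f (suc i)) + sumTo n (λ i → g (suc i)))
    ≡⟨ +-assoc-swap (f 0) (g 0) _ _ ⟩
  (f 0 + sumTo n (λ i → f (suc i))) + (g 0 + sumTo n (λ i → g (suc i))) ∎
  where
  open ≡-Reasoning
  +-assoc-swap : ∀ w x y z → (w + x) + (y + z) ≡ (w + y) + (x + z)
  +-assoc-swap = solve 4 (λ w x y z → (w :+ x) :+ (y :+ z) := (w :+ y) :+ (x :+ z)) refl

sumTo-split : ∀ m n (f : ℕ → ℕ) → sumTo (m + n) f ≡ sumTo m f + sumTo n (λ i → f (m + i))
sumTo-split zero    n f = refl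
sumTo-split (suc m) n f =
  trans (cong (f 0 +_) (sumTo-split m n (λ i → f (suc i)))) (sym (+-assoc (f 0) _ _))

sumTo-mono : ∀ n {f g : ℕ → ℕ} → (∀ i → f i ≤ g i) → sumTo n f ≤ sumTo n g
sumTo-mono zero    le = z≤n
sumTo-mono (suc n) le = +-mono-≤ (le 0) (sumTo-mono n (λ i → le (suc i)))

sumTo-≤1 : ∀ n (f : ℕ → ℕ) → (∀ i → f i ≤ 1) → sumTo n f ≤ n
sumTo-≤1 zero    f le = z≤n
sumTo-≤1 (suc n) f le = +-mono-≤ (le 0) (sumTo-≤1 n (λ i → f (suc i)) (λ i → le (suc i)))

sumTo-periodic : ∀ K (f : ℕ → ℕ) → (∀ i → f (K + i) ≡ f i) →
  ∀ q s → sumTo (q * K + s) f ≡ q * sumTo K f + sumTo s f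
sumTo-periodic K f per zero    s = refl
sumTo-periodic K f per (suc q) s = begin
  sumTo (K + q * K + s) f                         ≡⟨ cong (λ n → sumTo n f) (+-assoc K (q * K) s) ⟩
  sumTo (K + (q * K + s)) f                       ≡⟨ sumTo-split K (q * K + s) f ⟩
  sumTo K f + sumTo (q * K + s) (λ i → f (K + i)) ≡⟨ cong (sumTo K f +_) (sumTo-cong (q * K + s) (λ i _ → per i)) ⟩
  sumTo K f + sumTo (q * K + s) f                 ≡⟨ cong (sumTo K f +_) (sumTo-periodic K f per q s) ⟩
  sumTo K f + (q * sumTo K f + sumTo s f)         ≡⟨ sym (+-assoc (sumTo K f) _ _) ⟩
  sumTo K f + q * sumTo K f + sumTo s f           ∎
  where open ≡-Reasoning

lowDigitSum : ℕ → ℕ → ℕ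
lowDigitSum n x = sumTo n (λ k → bit k x)

lowDigitSum-zero : ∀ n → lowDigitSum n 0 ≡ 0
lowDigitSum-zero zero    = refl
lowDigitSum-zero (suc n) = lowDigitSum-zero n

half< : ∀ {x n} → x < 2 ^ suc n → x / 2 < 2 ^ n
half< {x} {n} lt = m<n*o⇒m/o<n (subst (x <_) (*-comm 2 (2 ^ n)) lt)

lowDigitSum-saturates : ∀ n j x → x < 2 ^ n → lowDigitSum (n + j) x ≡ lowDigitSum n x
lowDigitSum-saturates zero    j zero    lt         = lowDigitSum-zero j
lowDigitSum-saturates zero    j (suc x) (s≤s ())
lowDigitSum-saturates (suc n) j x       lt =
  cong (x % 2 +_) (lowDigitSum-saturates n j (x / 2) (half< {x} {n} lt))

lowDigitSum-stable : ∀ n m x → x < 2 ^ n → x < 2 ^ m → lowDigitSum n x ≡ lowDigitSum m x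
lowDigitSum-stable n m x x<2ⁿ x<2ᵐ = begin
  lowDigitSum n x       ≡⟨ sym (lowDigitSum-saturates n m x x<2ⁿ) ⟩
  lowDigitSum (n + m) x ≡⟨ cong (λ k → lowDigitSum k x) (+-comm n m) ⟩
  lowDigitSum (m + n) x ≡⟨ lowDigitSum-saturates m n x x<2ᵐ ⟩
  lowDigitSum m x       ∎
  where open ≡-Reasoning

n<2^n : ∀ n → n < 2 ^ n
n<2^n zero    = s≤s z≤n
n<2^n (suc n) = subst₂ _<_ (+-comm n 1) (cong (2 ^ n +_) (sym (+-identityʳ (2 ^ n))))
                       (+-mono-<-≤ (n<2^n n) (m^n>0 2 n))

s₂≡lowDigitSum : ∀ x → s₂ x ≡ lowDigitSum (suc x) x
s₂≡lowDigitSum x =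
  trans (cong sum (map-upTo (λ k → bit k x) (suc x))) (sum-applyUpTo (suc x) (λ k → bit k x))

s₂-rec : ∀ x → s₂ x ≡ x % 2 + s₂ (x / 2)
s₂-rec x = begin
  s₂ x                                   ≡⟨ s₂≡lowDigitSum x ⟩
  x % 2 + lowDigitSum x (x / 2)          ≡⟨ cong (x % 2 +_) (lowDigitSum-stable x (suc (x / 2)) (x / 2) below₁ below₂) ⟩
  x % 2 + lowDigitSum (suc (x / 2)) (x / 2) ≡⟨ cong (x % 2 +_) (sym (s₂≡lowDigitSum (x / 2))) ⟩
  x % 2 + s₂ (x / 2)                     ∎
  where
  open ≡-Reasoning
  below₁ : x / 2 < 2 ^ x
  below₁ = ≤-<-trans (m/n≤m x 2) (n<2^n x)
  below₂ : x / 2 < 2 ^ suc (x / 2)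
  below₂ = ≤-trans (n<2^n (x / 2)) (^-monoʳ-≤ 2 (n≤1+n (x / 2)))

-- The column-by-column addition automaton.

-- a state: the accumulated change of the digit sum and the current carry
State : Set
State = ℤ × ℕ

Δᶜ : ℕ → ℕ → ℕ → ℤ
Δᶜ a x c = ℤ.+ s₂ (x + a + c) ℤ.- ℤ.+ s₂ x

-- sum in the lowest column; its parity is the new digit, its half the outgoing carry
column : ℕ → ℕ → ℕ → ℕ
column a x c = a % 2 + x % 2 + c

digitChange : ℕ → ℕ → ℤ
digitChange t e = ℤ.+ (t % 2) ℤ.- ℤ.+ e

addChange : ℤ → State → State
addChange l (l′ , c) = (l ℤ.+ l′ , c)

run : ℕ → ℕ → ℕ → ℕ → State
run zero    a x c = (ℤ.+ 0 , c)
run (suc k) a x c =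
  addChange (digitChange (column a x c) (x % 2)) (run k (a / 2) (x / 2) (column a x c / 2))

div2 : ∀ e y → (e + y * 2) / 2 ≡ e / 2 + y
div2 e y = trans (+-distrib-/-∣ʳ e (divides y refl)) (cong (e / 2 +_) (m*n/n≡m y 2))

mod2 : ∀ e y → (e + y * 2) % 2 ≡ e % 2
mod2 e y = [m+kn]%n≡m%n e y 2

column-split : ∀ a x c → x + a + c ≡ column a x c + (x / 2 + a / 2) * 2
column-split a x c = begin
  x + a + c                                          ≡⟨ cong₂ (λ u v → u + v + c) (m≡m%n+[m/n]*n x 2) (m≡m%n+[m/n]*n a 2) ⟩
  (x % 2 + (x / 2) * 2) + (a % 2 + (a / 2) * 2) + c  ≡⟨ regroup (x % 2) (x / 2) (a % 2) (a / 2) c ⟩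
  column a x c + (x / 2 + a / 2) * 2                 ∎
  where
  open ≡-Reasoning
  regroup : ∀ x₀ x′ a₀ a′ c → (x₀ + x′ * 2) + (a₀ + a′ * 2) + c ≡ a₀ + x₀ + c + (x′ + a′) * 2
  regroup = solve 5 (λ x₀ x′ a₀ a′ c → (x₀ :+ x′ :* con 2) :+ (a₀ :+ a′ :* con 2) :+ c
                                     := a₀ :+ x₀ :+ c :+ (x′ :+ a′) :* con 2) refl

pos-sub-+ : ∀ p q r s → ℤ.+ (p + q) ℤ.- ℤ.+ (r + s) ≡ (ℤ.+ p ℤ.- ℤ.+ r) ℤ.+ (ℤ.+ q ℤ.- ℤ.+ s)
pos-sub-+ p q r s = begin
  ℤ.+ (p + q) ℤ.- ℤ.+ (r + s)             ≡⟨ cong₂ ℤ._-_ (ℤP.pos-+ p q) (ℤP.pos-+ r s) ⟩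
  (ℤ.+ p ℤ.+ ℤ.+ q) ℤ.- (ℤ.+ r ℤ.+ ℤ.+ s) ≡⟨ regroup (ℤ.+ p) (ℤ.+ q) (ℤ.+ r) (ℤ.+ s) ⟩
  (ℤ.+ p ℤ.- ℤ.+ r) ℤ.+ (ℤ.+ q ℤ.- ℤ.+ s) ∎
  where
  open ≡-Reasoning
  regroup : ∀ p q r s → (p ℤ.+ q) ℤ.- (r ℤ.+ s) ≡ (p ℤ.- r) ℤ.+ (q ℤ.- s)
  regroup = ZS.solve 4 (λ p q r s → (p ZS.:+ q) ZS.:- (r ZS.:+ s) ZS.:= (p ZS.:- r) ZS.:+ (q ZS.:- s)) refl

Δᶜ-step : ∀ a x c → Δᶜ a x c ≡ digitChange (column a x c) (x % 2) ℤ.+ Δᶜ (a / 2) (x / 2) (column a x c / 2)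
Δᶜ-step a x c = begin
  ℤ.+ s₂ (x + a + c) ℤ.- ℤ.+ s₂ x
    ≡⟨ cong₂ (λ u v → ℤ.+ s₂ u ℤ.- ℤ.+ v) (column-split a x c) (s₂-rec x) ⟩
  ℤ.+ s₂ (t + y * 2) ℤ.- ℤ.+ (x % 2 + s₂ (x / 2))
    ≡⟨ cong (λ u → ℤ.+ u ℤ.- ℤ.+ (x % 2 + s₂ (x / 2))) (s₂-rec (t + y * 2)) ⟩
  ℤ.+ ((t + y * 2) % 2 + s₂ ((t + y * 2) / 2)) ℤ.- ℤ.+ (x % 2 + s₂ (x / 2))
    ≡⟨ cong₂ (λ u v → ℤ.+ (u + s₂ v) ℤ.- ℤ.+ (x % 2 + s₂ (x / 2))) (mod2 t y) (trans (div2 t y) (+-comm (t / 2) y)) ⟩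
  ℤ.+ (t % 2 + s₂ (y + t / 2)) ℤ.- ℤ.+ (x % 2 + s₂ (x / 2))
    ≡⟨ pos-sub-+ (t % 2) _ (x % 2) _ ⟩
  digitChange t (x % 2) ℤ.+ Δᶜ (a / 2) (x / 2) (t / 2) ∎
  where
  open ≡-Reasoning
  t = column a x c
  y = x / 2 + a / 2

Δᶜ-split : ∀ k a x c →
  Δᶜ a x c ≡ proj₁ (run k a x c) ℤ.+ Δᶜ (shiftR k a) (shiftR k x) (proj₂ (run k a x c))
Δᶜ-split zero    a x c = sym (ℤP.+-identityˡ _)
Δᶜ-split (suc k) a x c = begin
  Δᶜ a x c                                         ≡⟨ Δᶜ-step a x c ⟩
  e ℤ.+ Δᶜ (a / 2) (x / 2) (t / 2)                 ≡⟨ cong (ℤ._+_ e) (Δᶜ-split k (a / 2) (x / 2) (t / 2)) ⟩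
  e ℤ.+ (proj₁ r ℤ.+ Δᶜ (shiftR k (a / 2)) (shiftR k (x / 2)) (proj₂ r))
    ≡⟨ sym (ℤP.+-assoc e (proj₁ r) _) ⟩
  (e ℤ.+ proj₁ r) ℤ.+ Δᶜ (shiftR k (a / 2)) (shiftR k (x / 2)) (proj₂ r) ∎
  where
  open ≡-Reasoning
  t = column a x c
  e = digitChange t (x % 2)
  r = run k (a / 2) (x / 2) (t / 2)

addChange-zero : ∀ p → addChange (ℤ.+ 0) p ≡ p
addChange-zero (l , c) = cong (_, c) (ℤP.+-identityˡ l)

addChange-assoc : ∀ l l′ p → addChange l (addChange l′ p) ≡ addChange (l ℤ.+ l′) p
addChange-assoc l l′ (l″ , c) = cong (_, c) (sym (ℤP.+-assoc l l′ l″))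

run-split : ∀ k j a x c →
  run (k + j) a x c ≡ addChange (proj₁ (run k a x c)) (run j (shiftR k a) (shiftR k x) (proj₂ (run k a x c)))
run-split zero    j a x c = sym (addChange-zero (run j a x c))
run-split (suc k) j a x c =
  trans (cong (addChange e) (run-split k j (a / 2) (x / 2) (t / 2)))
        (addChange-assoc e (proj₁ (run k (a / 2) (x / 2) (t / 2))) _)
  where
  t = column a x c
  e = digitChange t (x % 2)

run-periodic : ∀ k a x c → run k a (2 ^ k + x) c ≡ run k a x c
run-periodic zero    a x c = refl
run-periodic (suc k) a x c = begin
  run (suc k) a (2 ^ k + (2 ^ k + 0) + x) c
    ≡⟨ cong (λ z → run (suc k) a z c) (regroup (2 ^ k) x) ⟩
  run (suc k) a (x + 2 ^ k * 2) c
    ≡⟨ cong₂ (λ u v → addChange (digitChange (a % 2 + u + c) u) (run k (a / 2) v ((a % 2 + u + c) / 2)))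
             (mod2 x (2 ^ k)) (trans (div2 x (2 ^ k)) (+-comm (x / 2) (2 ^ k))) ⟩
  addChange (digitChange t (x % 2)) (run k (a / 2) (2 ^ k + x / 2) (t / 2))
    ≡⟨ cong (addChange (digitChange t (x % 2))) (run-periodic k (a / 2) (x / 2) (t / 2)) ⟩
  run (suc k) a x c ∎
  where
  open ≡-Reasoning
  t = column a x c
  regroup : ∀ p x → p + (p + 0) + x ≡ x + p * 2
  regroup = solve 2 (λ p x → p :+ (p :+ con 0) :+ x := x :+ p :* con 2) refl

shiftR-small : ∀ k x → x < 2 ^ k → shiftR k x ≡ 0
shiftR-small zero    zero    lt         = refl
shiftR-small zero    (suc x) (s≤s ())
shiftR-small (suc k) x       lt         = shiftR-small k (x / 2) (half< {x} {k} lt)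

shiftR-top : ∀ k x → x < 2 ^ k → shiftR k (2 ^ k + x) ≡ 1
shiftR-top zero    zero    lt       = refl
shiftR-top zero    (suc x) (s≤s ())
shiftR-top (suc k) x       lt       = begin
  shiftR k ((2 ^ k + (2 ^ k + 0) + x) / 2) ≡⟨ cong (λ z → shiftR k (z / 2)) (regroup (2 ^ k) x) ⟩
  shiftR k ((x + 2 ^ k * 2) / 2)           ≡⟨ cong (shiftR k) (trans (div2 x (2 ^ k)) (+-comm (x / 2) (2 ^ k))) ⟩
  shiftR k (2 ^ k + x / 2)                 ≡⟨ shiftR-top k (x / 2) (half< {x} {k} lt) ⟩
  1                                        ∎
  where
  open ≡-Reasoning
  regroup : ∀ p x → p + (p + 0) + x ≡ x + p * 2
  regroup = solve 2 (λ p x → p :+ (p :+ con 0) :+ x := x :+ p :* con 2) refl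

carry≤1 : ∀ k a x c → c ≤ 1 → proj₂ (run k a x c) ≤ 1
carry≤1 zero    a x c c≤1 = c≤1
carry≤1 (suc k) a x c c≤1 =
  carry≤1 k (a / 2) (x / 2) (column a x c / 2)
          (/-monoˡ-≤ {column a x c} {3} 2 (+-mono-≤ (+-mono-≤ (digit≤1 a) (digit≤1 x)) c≤1))
  where
  digit≤1 : ∀ z → z % 2 ≤ 1
  digit≤1 z = ≤-pred (m%n<n z 2)

Δᶜ-nothing : ∀ y → Δᶜ 0 y 0 ≡ ℤ.+ 0
Δᶜ-nothing y = trans (cong (λ z → ℤ.+ s₂ z ℤ.- ℤ.+ s₂ y) (trans (+-identityʳ (y + 0)) (+-identityʳ y)))
                     (ℤP.+-inverseʳ (ℤ.+ s₂ y))

run-nothing : ∀ j y → run j 0 y 0 ≡ (ℤ.+ 0 , 0)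
run-nothing zero    y = refl
run-nothing (suc j) y rewrite +-identityʳ (y % 2) | m<n⇒m/n≡0 (m%n<n y 2) | run-nothing j (y / 2)
  = cong (_, 0) (trans (ℤP.+-identityʳ _)
                       (trans (cong (λ z → ℤ.+ z ℤ.- ℤ.+ (y % 2)) (m%n%n≡m%n y 2)) (ℤP.+-inverseʳ (ℤ.+ (y % 2)))))

⟦_⟧ : Bool → ℕ
⟦ b ⟧ = if b then 1 else 0

isChange : ℤ → ℤ → ℕ
isChange d l = ⟦ does (l ℤ.≟ d) ⟧

isState : ℤ → ℕ → State → ℕ
isState d c p = if does (proj₂ p ℕ.≟ c) then isChange d (proj₁ p) else 0

hasCarry : State → ℕ
hasCarry p = ⟦ does (proj₂ p ℕ.≟ 1) ⟧

isChange≤1 : ∀ d l → isChange d l ≤ 1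
isChange≤1 d l with does (l ℤ.≟ d)
... | true  = s≤s z≤n
... | false = z≤n

isState≤1 : ∀ d c p → isState d c p ≤ 1
isState≤1 d c (l , c′) with does (c′ ℕ.≟ c)
... | true  = isChange≤1 d l
... | false = z≤n

hasCarry≤1 : ∀ p → hasCarry p ≤ 1
hasCarry≤1 (l , c) with does (c ℕ.≟ 1)
... | true  = s≤s z≤n
... | false = z≤n

isState-carries≤1 : ∀ d p → isState d 0 p + isState d 1 p ≤ 1
isState-carries≤1 d (l , 0)           = subst (_≤ 1) (sym (+-identityʳ _)) (isChange≤1 d l)
isState-carries≤1 d (l , 1)           = isChange≤1 d l
isState-carries≤1 d (l , suc (suc c)) = z≤n

isChange-shift : ∀ d l z d′ → d′ ℤ.+ z ≡ d → isChange d (l ℤ.+ z) ≡ isChange d′ l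
isChange-shift d l z d′ refl with l ℤ.+ z ℤ.≟ d′ ℤ.+ z | l ℤ.≟ d′
... | yes _  | yes _  = refl
... | no _   | no _   = refl
... | no ne  | yes eq = contradiction (cong (ℤ._+ z) eq) ne
... | yes eq | no ne  = contradiction (∙-cancelʳ z l d′ eq) ne

length-filter : ∀ {P : ℕ → Set} (P? : ∀ x → Dec (P x)) n (f : ℕ → ℕ) →
  length (filter P? (applyUpTo f n)) ≡ sumTo n (λ i → ⟦ does (P? (f i)) ⟧)
length-filter P? zero    f = refl
length-filter P? (suc n) f with does (P? (f 0))
... | true  = cong suc (length-filter P? n (λ i → f (suc i)))
... | false = length-filter P? n (λ i → f (suc i))

count-sum : ∀ a d N → count a d N ≡ sumTo (suc N) (λ x → isChange d (Δ a x))
count-sum a d N = length-filter (λ x → Δ a x ℤ.≟ d) (suc N) (λ x → x)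

stateCount : ℕ → ℕ → ℤ → ℕ → ℕ
stateCount a k d c = sumTo (2 ^ k) (λ r → isState d c (run k a r 0))

topStep : ℕ → ℕ → State → State
topStep B e p =
  ( proj₁ p ℤ.+ (digitChange (B + e % 2 + proj₂ p) (e % 2) ℤ.+ ℤ.+ 0)
  , (B + e % 2 + proj₂ p) / 2 )

run-top : ∀ k a x c → run (suc k) a x c ≡ topStep (bit k a) (shiftR k x) (run k a x c)
run-top k a x c = trans (cong (λ z → run z a x c) (+-comm 1 k)) (run-split k 1 a x c)

-- residues below 2^(k+1) are those below 2^k, with top digit 0 or 1
sum-top : ∀ k a (g : State → ℕ) →
  sumTo (2 ^ suc k) (λ r → g (run (suc k) a r 0)) ≡
  sumTo (2 ^ k) (λ r → g (topStep (bit k a) 0 (run k a r 0))) +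
  sumTo (2 ^ k) (λ r → g (topStep (bit k a) 1 (run k a r 0)))
sum-top k a g = begin
  sumTo (2 ^ k + (2 ^ k + 0)) f                               ≡⟨ sumTo-split (2 ^ k) (2 ^ k + 0) f ⟩
  sumTo (2 ^ k) f + sumTo (2 ^ k + 0) (λ i → f (2 ^ k + i))
    ≡⟨ cong (λ n → sumTo (2 ^ k) f + sumTo n (λ i → f (2 ^ k + i))) (+-identityʳ (2 ^ k)) ⟩
  sumTo (2 ^ k) f + sumTo (2 ^ k) (λ i → f (2 ^ k + i))
    ≡⟨ cong₂ _+_ (sumTo-cong (2 ^ k) lower) (sumTo-cong (2 ^ k) upper) ⟩
  sumTo (2 ^ k) (λ r → g (topStep (bit k a) 0 (run k a r 0))) +
  sumTo (2 ^ k) (λ r → g (topStep (bit k a) 1 (run k a r 0))) ∎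
  where
  open ≡-Reasoning
  f : ℕ → ℕ
  f r = g (run (suc k) a r 0)
  lower : ∀ i → i < 2 ^ k → f i ≡ g (topStep (bit k a) 0 (run k a i 0))
  lower i lt = cong g (trans (run-top k a i 0) (cong (λ e → topStep (bit k a) e (run k a i 0)) (shiftR-small k i lt)))
  upper : ∀ i → i < 2 ^ k → f (2 ^ k + i) ≡ g (topStep (bit k a) 1 (run k a i 0))
  upper i lt = cong g (trans (run-top k a (2 ^ k + i) 0)
                             (cong₂ (topStep (bit k a)) (shiftR-top k i lt) (run-periodic k a i 0)))

count-step : ∀ k a B (g h : State → ℕ) → bit k a ≡ B →
  (∀ p → proj₂ p ≤ 1 → g (topStep B 0 p) + g (topStep B 1 p) ≡ h p) →
  sumTo (2 ^ suc k) (λ r → g (run (suc k) a r 0)) ≡ sumTo (2 ^ k) (λ r → h (run k a r 0))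
count-step k a B g h refl step = begin
  sumTo (2 ^ suc k) (λ r → g (run (suc k) a r 0)) ≡⟨ sum-top k a g ⟩
  sumTo (2 ^ k) (λ r → g (topStep B 0 (run k a r 0))) + sumTo (2 ^ k) (λ r → g (topStep B 1 (run k a r 0)))
    ≡⟨ sym (sumTo-+ (2 ^ k) _ _) ⟩
  sumTo (2 ^ k) (λ r → g (topStep B 0 (run k a r 0)) + g (topStep B 1 (run k a r 0)))
    ≡⟨ sumTo-cong (2 ^ k) (λ r _ → step (run k a r 0) (carry≤1 k a r 0 z≤n)) ⟩
  sumTo (2 ^ k) (λ r → h (run k a r 0)) ∎
  where open ≡-Reasoning

sumTo-+₃ : ∀ n (f g h : ℕ → ℕ) → sumTo n (λ i → f i + g i + h i) ≡ sumTo n f + sumTo n g + sumTo n h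
sumTo-+₃ n f g h = trans (sumTo-+ n (λ i → f i + g i) h) (cong (_+ sumTo n h) (sumTo-+ n f g))

private
  change-0 : ∀ d → d ℤ.+ ℤ.+ 0 ≡ d
  change-0 = ℤP.+-identityʳ

  change-+1 : ∀ d → d ℤ.- ℤ.+ 1 ℤ.+ ℤ.+ 1 ≡ d
  change-+1 = ZS.solve 1 (λ d → d ZS.:- ZS.con (ℤ.+ 1) ZS.:+ ZS.con (ℤ.+ 1) ZS.:= d) refl

  change-−1 : ∀ d → d ℤ.+ ℤ.+ 1 ℤ.+ ℤ.- ℤ.+ 1 ≡ d
  change-−1 = ZS.solve 1 (λ d → d ZS.:+ ZS.con (ℤ.+ 1) ZS.:+ ZS.:- ZS.con (ℤ.+ 1) ZS.:= d) refl

-- The top-column transitions, for a state (l , c) and digit 0 of a: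
-- without carry both digits of x give (l , 0); with carry, digit 0 gives (l+1 , 0)
-- and digit 1 gives (l−1 , 1).
step-digit₀-carry₀ : ∀ d l c → c ≤ 1 →
  isState d 0 (topStep 0 0 (l , c)) + isState d 0 (topStep 0 1 (l , c)) ≡
  isState d 0 (l , c) + isState d 0 (l , c) + isState (d ℤ.- ℤ.+ 1) 1 (l , c)
step-digit₀-carry₀ d l 0 _ = trans (cong₂ _+_ (isChange-shift d l _ d (change-0 d)) (isChange-shift d l _ d (change-0 d)))
                                   (sym (+-identityʳ _))
step-digit₀-carry₀ d l 1 _ = trans (+-identityʳ _) (isChange-shift d l _ (d ℤ.- ℤ.+ 1) (change-+1 d))
step-digit₀-carry₀ d l (suc (suc c)) (s≤s ())

step-digit₀-carry₁ : ∀ d l c → c ≤ 1 →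
  isState d 1 (topStep 0 0 (l , c)) + isState d 1 (topStep 0 1 (l , c)) ≡ isState (d ℤ.+ ℤ.+ 1) 1 (l , c)
step-digit₀-carry₁ d l 0 _ = refl
step-digit₀-carry₁ d l 1 _ = isChange-shift d l _ (d ℤ.+ ℤ.+ 1) (change-−1 d)
step-digit₀-carry₁ d l (suc (suc c)) (s≤s ())

-- For digit 1 of a: without carry, digit 0 of x gives (l+1 , 0) and digit 1 gives
-- (l−1 , 1); with carry both digits of x give (l , 1).
step-digit₁-carry₀ : ∀ d l c → c ≤ 1 →
  isState d 0 (topStep 1 0 (l , c)) + isState d 0 (topStep 1 1 (l , c)) ≡ isState (d ℤ.- ℤ.+ 1) 0 (l , c)
step-digit₁-carry₀ d l 0 _ = trans (+-identityʳ _) (isChange-shift d l _ (d ℤ.- ℤ.+ 1) (change-+1 d))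
step-digit₁-carry₀ d l 1 _ = refl
step-digit₁-carry₀ d l (suc (suc c)) (s≤s ())

step-digit₁-carry₁ : ∀ d l c → c ≤ 1 →
  isState d 1 (topStep 1 0 (l , c)) + isState d 1 (topStep 1 1 (l , c)) ≡
  isState (d ℤ.+ ℤ.+ 1) 0 (l , c) + isState d 1 (l , c) + isState d 1 (l , c)
step-digit₁-carry₁ d l 0 _ = trans (isChange-shift d l _ (d ℤ.+ ℤ.+ 1) (change-−1 d))
                                   (sym (trans (+-identityʳ _) (+-identityʳ _)))
step-digit₁-carry₁ d l 1 _ = cong₂ _+_ (isChange-shift d l _ d (change-0 d)) (isChange-shift d l _ d (change-0 d))
step-digit₁-carry₁ d l (suc (suc c)) (s≤s ())

-- the state counts follow the recursion of A₀ when the digit a_k is 0 ...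
counts-digit₀ : ∀ a k → bit k a ≡ 0 → ∀ d →
  (stateCount a (suc k) d 0 ≡ stateCount a k d 0 + stateCount a k d 0 + stateCount a k (d ℤ.- ℤ.+ 1) 1) ×
  (stateCount a (suc k) d 1 ≡ stateCount a k (d ℤ.+ ℤ.+ 1) 1)
counts-digit₀ a k a₀ d =
  trans (count-step k a 0 (isState d 0) _ a₀ (λ (l , c) → step-digit₀-carry₀ d l c)) (sumTo-+₃ (2 ^ k) _ _ _) ,
  count-step k a 0 (isState d 1) _ a₀ (λ (l , c) → step-digit₀-carry₁ d l c)

-- ... and the recursion of A₁ when it is 1
counts-digit₁ : ∀ a k → bit k a ≡ 1 → ∀ d →
  (stateCount a (suc k) d 0 ≡ stateCount a k (d ℤ.- ℤ.+ 1) 0) ×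
  (stateCount a (suc k) d 1 ≡ stateCount a k (d ℤ.+ ℤ.+ 1) 0 + stateCount a k d 1 + stateCount a k d 1)
counts-digit₁ a k a₁ d =
  count-step k a 1 (isState d 0) _ a₁ (λ (l , c) → step-digit₁-carry₀ d l c) ,
  trans (count-step k a 1 (isState d 1) _ a₁ (λ (l , c) → step-digit₁-carry₁ d l c)) (sumTo-+₃ (2 ^ k) _ _ _)

frac : ℕ → ℕ → ℚ
frac x m = ℤ.+ x ℚ./ suc m

frac-toℚᵘ : ∀ x m → toℚᵘ (frac x m) ℚᵘ.≃ mkℚᵘ (ℤ.+ x) m
frac-toℚᵘ x m = ℚP.toℚᵘ-fromℚᵘ (mkℚᵘ (ℤ.+ x) m)

frac-cong : ∀ x m y n → x * suc n ≡ y * suc m → frac x m ≡ frac y n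
frac-cong x m y n eq =
  ℚP.fromℚᵘ-cong {mkℚᵘ (ℤ.+ x) m} {mkℚᵘ (ℤ.+ y) n}
    (*≡* (trans (sym (ℤP.pos-* x (suc n))) (trans (cong ℤ.+_ eq) (ℤP.pos-* y (suc m)))))

frac-+ : ∀ x y m → frac x m ℚ.+ frac y m ≡ frac (x + y) m
frac-+ x y m = ℚP.toℚᵘ-injective (begin
  toℚᵘ (frac x m ℚ.+ frac y m)            ≈⟨ ℚP.toℚᵘ-homo-+ (frac x m) (frac y m) ⟩
  toℚᵘ (frac x m) ℚᵘ.+ toℚᵘ (frac y m)    ≈⟨ ℚᵘP.+-cong (frac-toℚᵘ x m) (frac-toℚᵘ y m) ⟩
  mkℚᵘ (ℤ.+ x) m ℚᵘ.+ mkℚᵘ (ℤ.+ y) m      ≈⟨ *≡* cross ⟩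
  mkℚᵘ (ℤ.+ (x + y)) m                    ≈⟨ ℚᵘP.≃-sym (frac-toℚᵘ (x + y) m) ⟩
  toℚᵘ (frac (x + y) m)                   ∎)
  where
  open ℚᵘP.≃-Reasoning
  s = ℤ.+ suc m
  cross : (ℤ.+ x ℤ.* s ℤ.+ ℤ.+ y ℤ.* s) ℤ.* s ≡ ℤ.+ (x + y) ℤ.* ℤ.+ (suc m * suc m)
  cross = trans (ZS.solve 3 (λ x y s → (x ZS.:* s ZS.:+ y ZS.:* s) ZS.:* s ZS.:= (x ZS.:+ y) ZS.:* (s ZS.:* s))
                          refl (ℤ.+ x) (ℤ.+ y) s)
                (sym (cong₂ ℤ._*_ (ℤP.pos-+ x y) (ℤP.pos-* (suc m) (suc m))))

frac-double : ∀ x m → frac x m ≡ frac (x + x) (m + suc m)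
frac-double x m = frac-cong x m (x + x) (m + suc m)
  (solve 2 (λ x m → x :* (con 1 :+ (m :+ (con 1 :+ m))) := (x :+ x) :* (con 1 :+ m)) refl x m)

frac-half : ∀ x m → ½ ℚ.* frac x m ≡ frac x (m + suc m)
frac-half x m = begin
  ½ ℚ.* frac x m           ≡⟨ cong (½ ℚ.*_) (trans (frac-double x m) (sym (frac-+ x x (m + suc m)))) ⟩
  ½ ℚ.* (w ℚ.+ w)          ≡⟨ ℚP.*-distribˡ-+ ½ w w ⟩
  ½ ℚ.* w ℚ.+ ½ ℚ.* w      ≡⟨ sym (ℚP.*-distribʳ-+ w ½ ½) ⟩
  (½ ℚ.+ ½) ℚ.* w          ≡⟨ ℚP.*-identityˡ w ⟩
  w                        ∎
  where
  open ≡-Reasoning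
  w = frac x (m + suc m)

-- The matrix product as normalised state counts.

-- 2^k − 1, built so that the successor of pred2^ (k+1) is twice that of pred2^ k
pred2^ : ℕ → ℕ
pred2^ zero    = 0
pred2^ (suc k) = pred2^ k + suc (pred2^ k)

suc-pred2^ : ∀ k → suc (pred2^ k) ≡ 2 ^ k
suc-pred2^ zero    = refl
suc-pred2^ (suc k) = begin
  suc (pred2^ k) + suc (pred2^ k) ≡⟨ cong₂ _+_ (suc-pred2^ k) (suc-pred2^ k) ⟩
  2 ^ k + 2 ^ k                   ≡⟨ cong (2 ^ k +_) (sym (+-identityʳ (2 ^ k))) ⟩
  2 ^ k + (2 ^ k + 0)             ∎
  where open ≡-Reasoning

partialProduct : ℕ → ℕ → L × L
partialProduct a zero    = (δ₀ , zeroL)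
partialProduct a (suc k) = A (bit k a) (partialProduct a k)

-- the product sequence of the statement uses n + 1 factors
prodVec-partial : ∀ a n → prodVec a n ≡ partialProduct a (suc n)
prodVec-partial a zero    = refl
prodVec-partial a (suc n) = cong (A (bit (suc n) a)) (prodVec-partial a n)

A₀-row₁ : ∀ x y m → frac x m ℚ.+ ½ ℚ.* frac y m ≡ frac (x + x + y) (m + suc m)
A₀-row₁ x y m = trans (cong₂ ℚ._+_ (frac-double x m) (frac-half y m)) (frac-+ (x + x) y (m + suc m))

A₁-row₂ : ∀ x y m → ½ ℚ.* frac x m ℚ.+ frac y m ≡ frac (x + y + y) (m + suc m)
A₁-row₂ x y m = trans (cong₂ ℚ._+_ (frac-half x m) (frac-double y m))
                      (trans (frac-+ x (y + y) (m + suc m)) (cong (λ z → frac z (m + suc m)) (sym (+-assoc x y y))))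

δ₀-count : ∀ a d → δ₀ d ≡ frac (stateCount a 0 d 0) 0
δ₀-count a d with d ℤ.≟ ℤ.+ 0 | ℤ.+ 0 ℤ.≟ d
... | yes _  | yes _  = refl
... | no _   | no _   = refl
... | yes eq | no ne  = ⊥-elim (ne (sym eq))
... | no ne  | yes eq = ⊥-elim (ne (sym eq))

Represents : ℕ → ℕ → L × L → Set
Represents a k w = ∀ d → (proj₁ w d ≡ frac (stateCount a k d 0) (pred2^ k)) ×
                         (proj₂ w d ≡ frac (stateCount a k d 1) (pred2^ k))

A₀-counts : ∀ a k w → bit k a ≡ 0 → Represents a k w → Represents a (suc k) (A 0 w)
A₀-counts a k w aₖ w-counts d = row₁ , row₂
  where
  open ≡-Reasoning
  m = pred2^ k
  U V : ℤ → ℕ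
  U e = stateCount a k e 0
  V e = stateCount a k e 1
  row₁ : proj₁ w d ℚ.+ ½ ℚ.* proj₂ w (d ℤ.- ℤ.+ 1) ≡ frac (stateCount a (suc k) d 0) (pred2^ (suc k))
  row₁ = begin
    proj₁ w d ℚ.+ ½ ℚ.* proj₂ w (d ℤ.- ℤ.+ 1)
      ≡⟨ cong₂ (λ u v → u ℚ.+ ½ ℚ.* v) (proj₁ (w-counts d)) (proj₂ (w-counts (d ℤ.- ℤ.+ 1))) ⟩
    frac (U d) m ℚ.+ ½ ℚ.* frac (V (d ℤ.- ℤ.+ 1)) m   ≡⟨ A₀-row₁ (U d) (V (d ℤ.- ℤ.+ 1)) m ⟩
    frac (U d + U d + V (d ℤ.- ℤ.+ 1)) (m + suc m)
      ≡⟨ cong (λ z → frac z (m + suc m)) (sym (proj₁ (counts-digit₀ a k aₖ d))) ⟩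
    frac (stateCount a (suc k) d 0) (pred2^ (suc k))  ∎
  row₂ : ½ ℚ.* proj₂ w (d ℤ.+ ℤ.+ 1) ≡ frac (stateCount a (suc k) d 1) (pred2^ (suc k))
  row₂ = begin
    ½ ℚ.* proj₂ w (d ℤ.+ ℤ.+ 1)                       ≡⟨ cong (½ ℚ.*_) (proj₂ (w-counts (d ℤ.+ ℤ.+ 1))) ⟩
    ½ ℚ.* frac (V (d ℤ.+ ℤ.+ 1)) m                    ≡⟨ frac-half (V (d ℤ.+ ℤ.+ 1)) m ⟩
    frac (V (d ℤ.+ ℤ.+ 1)) (m + suc m)
      ≡⟨ cong (λ z → frac z (m + suc m)) (sym (proj₂ (counts-digit₀ a k aₖ d))) ⟩
    frac (stateCount a (suc k) d 1) (pred2^ (suc k))  ∎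

A₁-counts : ∀ a k w → bit k a ≡ 1 → Represents a k w → Represents a (suc k) (A 1 w)
A₁-counts a k w aₖ w-counts d = row₁ , row₂
  where
  open ≡-Reasoning
  m = pred2^ k
  U V : ℤ → ℕ
  U e = stateCount a k e 0
  V e = stateCount a k e 1
  row₁ : ½ ℚ.* proj₁ w (d ℤ.- ℤ.+ 1) ≡ frac (stateCount a (suc k) d 0) (pred2^ (suc k))
  row₁ = begin
    ½ ℚ.* proj₁ w (d ℤ.- ℤ.+ 1)                       ≡⟨ cong (½ ℚ.*_) (proj₁ (w-counts (d ℤ.- ℤ.+ 1))) ⟩
    ½ ℚ.* frac (U (d ℤ.- ℤ.+ 1)) m                    ≡⟨ frac-half (U (d ℤ.- ℤ.+ 1)) m ⟩
    frac (U (d ℤ.- ℤ.+ 1)) (m + suc m)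
      ≡⟨ cong (λ z → frac z (m + suc m)) (sym (proj₁ (counts-digit₁ a k aₖ d))) ⟩
    frac (stateCount a (suc k) d 0) (pred2^ (suc k))  ∎
  row₂ : ½ ℚ.* proj₁ w (d ℤ.+ ℤ.+ 1) ℚ.+ proj₂ w d ≡ frac (stateCount a (suc k) d 1) (pred2^ (suc k))
  row₂ = begin
    ½ ℚ.* proj₁ w (d ℤ.+ ℤ.+ 1) ℚ.+ proj₂ w d
      ≡⟨ cong₂ (λ u v → ½ ℚ.* u ℚ.+ v) (proj₁ (w-counts (d ℤ.+ ℤ.+ 1))) (proj₂ (w-counts d)) ⟩
    ½ ℚ.* frac (U (d ℤ.+ ℤ.+ 1)) m ℚ.+ frac (V d) m   ≡⟨ A₁-row₂ (U (d ℤ.+ ℤ.+ 1)) (V d) m ⟩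
    frac (U (d ℤ.+ ℤ.+ 1) + V d + V d) (m + suc m)
      ≡⟨ cong (λ z → frac z (m + suc m)) (sym (proj₂ (counts-digit₁ a k aₖ d))) ⟩
    frac (stateCount a (suc k) d 1) (pred2^ (suc k))  ∎

product-counts : ∀ a k → Represents a k (partialProduct a k)
product-counts a zero    d = δ₀-count a d , refl
product-counts a (suc k) with bit k a in aₖ
... | 0           = A₀-counts a k (partialProduct a k) aₖ (product-counts a k)
... | 1           = A₁-counts a k (partialProduct a k) aₖ (product-counts a k)
... | suc (suc _) = ⊥-elim (<⇒≱ (m%n<n (shiftR k a) 2) (subst (2 ≤_) (sym aₖ) (s≤s (s≤s z≤n))))

stateTotal : ℕ → ℕ → ℤ → ℕ
stateTotal a n d = stateCount a n d 0 + stateCount a n d 1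

prodSeq-counts : ∀ a n d → prodSeq a n d ≡ frac (stateTotal a (suc n) d) (pred2^ (suc n))
prodSeq-counts a n d = begin
  proj₁ (prodVec a n) d ℚ.+ proj₂ (prodVec a n) d
    ≡⟨ cong (λ p → proj₁ p d ℚ.+ proj₂ p d) (prodVec-partial a n) ⟩
  proj₁ (partialProduct a (suc n)) d ℚ.+ proj₂ (partialProduct a (suc n)) d
    ≡⟨ cong₂ ℚ._+_ (proj₁ (product-counts a (suc n) d)) (proj₂ (product-counts a (suc n) d)) ⟩
  frac (stateCount a (suc n) d 0) (pred2^ (suc n)) ℚ.+ frac (stateCount a (suc n) d 1) (pred2^ (suc n))
    ≡⟨ frac-+ (stateCount a (suc n) d 0) (stateCount a (suc n) d 1) (pred2^ (suc n)) ⟩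
  frac (stateTotal a (suc n) d) (pred2^ (suc n)) ∎
  where open ≡-Reasoning

infix 4 _≈[_]_
_≈[_]_ : ℕ → ℕ → ℕ → Set
x ≈[ e ] y = (x ≤ y + e) × (y ≤ x + e)

≈-sym : ∀ {x y e} → x ≈[ e ] y → y ≈[ e ] x
≈-sym (x≤ , y≤) = y≤ , x≤

≈-weaken : ∀ {x y e f} → e ≤ f → x ≈[ e ] y → x ≈[ f ] y
≈-weaken {x} {y} e≤f (x≤ , y≤) = ≤-trans x≤ (+-monoʳ-≤ y e≤f) , ≤-trans y≤ (+-monoʳ-≤ x e≤f)

≈-trans : ∀ {x y z e f} → x ≈[ e ] y → y ≈[ f ] z → x ≈[ e + f ] z
≈-trans {x} {y} {z} {e} {f} (x≤ , y≤) (y≤′ , z≤) =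
  (begin x ≤⟨ x≤ ⟩ y + e ≤⟨ +-monoˡ-≤ e y≤′ ⟩ z + f + e ≡⟨ +-assoc z f e ⟩
         z + (f + e) ≡⟨ cong (z +_) (+-comm f e) ⟩ z + (e + f) ∎) ,
  (begin z ≤⟨ z≤ ⟩ y + f ≤⟨ +-monoˡ-≤ f y≤ ⟩ x + e + f ≡⟨ +-assoc x e f ⟩ x + (e + f) ∎)
  where open ≤-Reasoning

≈-*ʳ : ∀ {x y e} c → x ≈[ e ] y → x * c ≈[ e * c ] y * c
≈-*ʳ {x} {y} {e} c (x≤ , y≤) =
  ≤-trans (*-monoˡ-≤ c x≤) (≤-reflexive (*-distribʳ-+ c y e)) ,
  ≤-trans (*-monoˡ-≤ c y≤) (≤-reflexive (*-distribʳ-+ c x e))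

≈-*ˡ : ∀ {x y e} c → x ≈[ e ] y → c * x ≈[ c * e ] c * y
≈-*ˡ {x} {y} {e} c x≈y rewrite *-comm c x | *-comm c y | *-comm c e = ≈-*ʳ c x≈y

≈-reflexive : ∀ {x y} → x ≡ y → x ≈[ 0 ] y
≈-reflexive {x} {y} refl = ≤-reflexive (sym (+-identityʳ x)) , ≤-reflexive (sym (+-identityʳ x))

≈-drop : ∀ x {y s} → y ≤ s → x + y ≈[ s ] x
≈-drop x {y} {s} y≤s = +-monoʳ-≤ x y≤s , ≤-trans (m≤m+n x y) (m≤m+n (x + y) s)

≈-sum : ∀ n (f g e : ℕ → ℕ) → (∀ i → f i ≈[ e i ] g i) → sumTo n f ≈[ sumTo n e ] sumTo n g
≈-sum n f g e f≈g =
  ≤-trans (sumTo-mono n (λ i → proj₁ (f≈g i))) (≤-reflexive (sumTo-+ n g e)) ,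
  ≤-trans (sumTo-mono n (λ i → proj₂ (f≈g i))) (≤-reflexive (sumTo-+ n f e))

≈-resp : ∀ {x x′ e e′ y y′} → x ≡ x′ → e ≡ e′ → y ≡ y′ → x ≈[ e ] y → x′ ≈[ e′ ] y′
≈-resp refl refl refl x≈y = x≈y

∣⊖∣≤ : ∀ {x y e} → x ≈[ e ] y → ℤ.∣ x ⊖ y ∣ ≤ e
∣⊖∣≤ {x} {y} {e} (x≤ , y≤) with ≤-total x y
... | inj₁ x≤y = subst (_≤ e) (sym (ℤP.∣⊖∣-≤ x≤y)) (m≤n+o⇒m∸n≤o y x y≤)
... | inj₂ y≤x = subst (_≤ e) (sym (trans (ℤP.∣m⊖n∣≡∣n⊖m∣ x y) (ℤP.∣⊖∣-≤ y≤x))) (m≤n+o⇒m∸n≤o x y x≤)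

-- Stabilisation above the digits of a.

carryCount : ℕ → ℕ → ℕ
carryCount a k = sumTo (2 ^ k) (λ r → hasCarry (run k a r 0))

-- in a column where a has digit 0, a carry goes on exactly when x has digit 1
carry-step₀ : ∀ l c → c ≤ 1 → hasCarry (topStep 0 0 (l , c)) + hasCarry (topStep 0 1 (l , c)) ≡ hasCarry (l , c)
carry-step₀ l 0 _ = refl
carry-step₀ l 1 _ = refl
carry-step₀ l (suc (suc c)) (s≤s ())

bit-above : ∀ a k → a < 2 ^ k → bit k a ≡ 0
bit-above a k a<2ᵏ = cong (_% 2) (shiftR-small k a a<2ᵏ)

carryCount-stable : ∀ a k → a < 2 ^ k → carryCount a (suc k) ≡ carryCount a k
carryCount-stable a k a<2ᵏ =
  count-step k a 0 hasCarry hasCarry (bit-above a k a<2ᵏ) (λ (l , c) → carry-step₀ l c)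

carryCount-bound : ∀ a j t → a < 2 ^ j → carryCount a (j + t) ≤ 2 ^ j
carryCount-bound a j zero    a<2ʲ = subst (λ n → carryCount a n ≤ 2 ^ j) (sym (+-identityʳ j))
                                          (sumTo-≤1 (2 ^ j) _ (λ r → hasCarry≤1 (run j a r 0)))
carryCount-bound a j (suc t) a<2ʲ = subst (λ n → carryCount a n ≤ 2 ^ j) (sym (+-suc j t)) (begin
  carryCount a (suc (j + t)) ≡⟨ carryCount-stable a (j + t) (<-≤-trans a<2ʲ (^-monoʳ-≤ 2 (m≤m+n j t))) ⟩
  carryCount a (j + t)       ≤⟨ carryCount-bound a j t a<2ʲ ⟩
  2 ^ j                      ∎)
  where open ≤-Reasoning

isState-no-carry : ∀ d p → proj₂ p ≡ 0 → isState d 0 p ≡ isChange d (proj₁ p)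
isState-no-carry d (l , .0) refl = refl

change-settled : ∀ a d k x → a < 2 ^ k → proj₂ (run k a x 0) ≡ 0 →
  isChange d (Δ a x) ≡ isState d 0 (run k a x 0)
change-settled a d k x a<2ᵏ no-carry = begin
  isChange d (Δ a x)                                                ≡⟨ cong (isChange d) Δ≡Δᶜ ⟩
  isChange d (Δᶜ a x 0)                                             ≡⟨ cong (isChange d) (Δᶜ-split k a x 0) ⟩
  isChange d (proj₁ p ℤ.+ Δᶜ (shiftR k a) (shiftR k x) (proj₂ p))
    ≡⟨ cong₂ (λ a′ c → isChange d (proj₁ p ℤ.+ Δᶜ a′ (shiftR k x) c)) (shiftR-small k a a<2ᵏ) no-carry ⟩
  isChange d (proj₁ p ℤ.+ Δᶜ 0 (shiftR k x) 0)
    ≡⟨ cong (λ z → isChange d (proj₁ p ℤ.+ z)) (Δᶜ-nothing (shiftR k x)) ⟩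
  isChange d (proj₁ p ℤ.+ ℤ.+ 0)                                    ≡⟨ cong (isChange d) (ℤP.+-identityʳ (proj₁ p)) ⟩
  isChange d (proj₁ p)                                              ≡⟨ sym (isState-no-carry d p no-carry) ⟩
  isState d 0 p                                                     ∎
  where
  open ≡-Reasoning
  p = run k a x 0
  Δ≡Δᶜ : Δ a x ≡ Δᶜ a x 0
  Δ≡Δᶜ = cong (λ z → ℤ.+ s₂ z ℤ.- ℤ.+ s₂ x) (sym (+-identityʳ (x + a)))

stateTotal-sum : ∀ a n d →
  stateTotal a n d ≡ sumTo (2 ^ n) (λ r → isState d 0 (run n a r 0) + isState d 1 (run n a r 0))
stateTotal-sum a n d = sym (sumTo-+ (2 ^ n) _ _)

stateTotal≤ : ∀ a n d → stateTotal a n d ≤ 2 ^ n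
stateTotal≤ a n d = ≤-trans (≤-reflexive (stateTotal-sum a n d))
                            (sumTo-≤1 (2 ^ n) _ (λ r → isState-carries≤1 d (run n a r 0)))

total-settled : ∀ a d k j r → a < 2 ^ k → proj₂ (run k a r 0) ≡ 0 →
  isState d 0 (run (k + j) a r 0) + isState d 1 (run (k + j) a r 0) ≡ isState d 0 (run k a r 0)
total-settled a d k j r a<2ᵏ no-carry = begin
  total (run (k + j) a r 0)                                         ≡⟨ cong total (run-split k j a r 0) ⟩
  total (addChange (proj₁ p) (run j (shiftR k a) (shiftR k r) (proj₂ p)))
    ≡⟨ cong₂ (λ a′ c → total (addChange (proj₁ p) (run j a′ (shiftR k r) c))) (shiftR-small k a a<2ᵏ) no-carry ⟩
  total (addChange (proj₁ p) (run j 0 (shiftR k r) 0))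
    ≡⟨ cong (λ q → total (addChange (proj₁ p) q)) (run-nothing j (shiftR k r)) ⟩
  total (addChange (proj₁ p) (ℤ.+ 0 , 0))
    ≡⟨ trans (+-identityʳ _) (cong (isChange d) (ℤP.+-identityʳ (proj₁ p))) ⟩
  isChange d (proj₁ p)                                              ≡⟨ sym (isState-no-carry d p no-carry) ⟩
  isState d 0 p                                                     ∎
  where
  open ≡-Reasoning
  p = run k a r 0
  total : State → ℕ
  total q = isState d 0 q + isState d 1 q

≈-off-carry : ∀ d f p → proj₂ p ≤ 1 → f ≤ 1 → (proj₂ p ≡ 0 → f ≡ isState d 0 p) →
  f ≈[ hasCarry p ] isState d 0 p
≈-off-carry d f (l , 0)           _        _   agree = ≈-reflexive (agree refl)
≈-off-carry d f (l , 1)           _        f≤1 _     = f≤1 , z≤n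
≈-off-carry d f (l , suc (suc c)) (s≤s ()) _   _

sumTo-run-periodic : ∀ k a (h : State → ℕ) q s →
  sumTo (q * 2 ^ k + s) (λ r → h (run k a r 0)) ≡ q * sumTo (2 ^ k) (λ r → h (run k a r 0)) + sumTo s (λ r → h (run k a r 0))
sumTo-run-periodic k a h = sumTo-periodic (2 ^ k) _ (λ i → cong h (run-periodic k a i 0))

stateTotal-approx : ∀ a d k j → a < 2 ^ k →
  stateTotal a (k + j) d ≈[ 2 ^ j * carryCount a k ] 2 ^ j * stateCount a k d 0
stateTotal-approx a d k j a<2ᵏ =
  ≈-resp (sym (trans (stateTotal-sum a (k + j) d) (cong (λ n → sumTo n total) levels)))
         (periodic hasCarry) (periodic (isState d 0))
         (≈-sum (2 ^ j * 2 ^ k + 0) total _ _ pointwise)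
  where
  total : ℕ → ℕ
  total r = isState d 0 (run (k + j) a r 0) + isState d 1 (run (k + j) a r 0)
  levels : 2 ^ (k + j) ≡ 2 ^ j * 2 ^ k + 0
  levels = trans (^-distribˡ-+-* 2 k j) (trans (*-comm (2 ^ k) (2 ^ j)) (sym (+-identityʳ _)))
  periodic : ∀ (h : State → ℕ) →
    sumTo (2 ^ j * 2 ^ k + 0) (λ r → h (run k a r 0)) ≡ 2 ^ j * sumTo (2 ^ k) (λ r → h (run k a r 0))
  periodic h = trans (sumTo-run-periodic k a h (2 ^ j) 0) (+-identityʳ _)
  pointwise : ∀ r → total r ≈[ hasCarry (run k a r 0) ] isState d 0 (run k a r 0)
  pointwise r = ≈-off-carry d (total r) (run k a r 0) (carry≤1 k a r 0 z≤n)
                            (isState-carries≤1 d (run (k + j) a r 0)) (total-settled a d k j r a<2ᵏ)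

count-approx : ∀ a d k m q s → a < 2 ^ k → suc (suc m) ≡ q * 2 ^ k + s →
  count a d (suc m) ≈[ q * carryCount a k + s + s ] q * stateCount a k d 0
count-approx a d k m q s a<2ᵏ N≡ = ≈-trans bounded (≈-drop (q * g) (sumTo-≤1 s _ (λ r → isState≤1 d 0 (run k a r 0))))
  where
  g = stateCount a k d 0
  f : ℕ → ℕ
  f x = isChange d (Δ a x)
  pointwise : ∀ x → f x ≈[ hasCarry (run k a x 0) ] isState d 0 (run k a x 0)
  pointwise x = ≈-off-carry d (f x) (run k a x 0) (carry≤1 k a x 0 z≤n) (isChange≤1 d (Δ a x))
                            (change-settled a d k x a<2ᵏ)
  exact : count a d (suc m) ≈[ q * carryCount a k + sumTo s (λ r → hasCarry (run k a r 0)) ]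
          q * g + sumTo s (λ r → isState d 0 (run k a r 0))
  exact = ≈-resp (sym (trans (count-sum a d (suc m)) (cong (λ n → sumTo n f) N≡)))
                 (sumTo-run-periodic k a hasCarry q s) (sumTo-run-periodic k a (isState d 0) q s)
                 (≈-sum (q * 2 ^ k + s) f _ _ pointwise)
  bounded : count a d (suc m) ≈[ q * carryCount a k + s ] q * g + sumTo s (λ r → isState d 0 (run k a r 0))
  bounded = ≈-weaken (+-monoʳ-≤ (q * carryCount a k) (sumTo-≤1 s _ (λ r → hasCarry≤1 (run k a r 0)))) exact

cross-approx : ∀ C P Y q K q′ s g b → suc Y ≡ q′ * K + s → P ≤ q * K →
  C ≈[ q′ * b + s + s ] q′ * g → P ≈[ q * b ] q * g →
  C * (q * K) ≈[ q * K * (1 + 2 * (q′ * b) + 3 * s) ] P * Y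
cross-approx C P Y q K q′ s g b Y≡ P≤qK C≈ P≈ =
  ≈-weaken errors≤
    (≈-trans (≈-*ʳ (q * K) C≈)
    (≈-trans (≈-reflexive regroup)
    (≈-trans (≈-*ʳ (q′ * K) (≈-sym P≈))
             (≈-*ˡ P periods≈Y))))
  where
  open ≤-Reasoning
  regroup : q′ * g * (q * K) ≡ q * g * (q′ * K)
  regroup = solve 4 (λ q′ g q K → q′ :* g :* (q :* K) := q :* g :* (q′ :* K)) refl q′ g q K
  periods≈Y : q′ * K ≈[ 1 + s ] Y
  periods≈Y =
    (begin q′ * K ≤⟨ m≤m+n (q′ * K) s ⟩ q′ * K + s ≡⟨ sym Y≡ ⟩ 1 + Y ≡⟨ +-comm 1 Y ⟩
           Y + 1 ≤⟨ +-monoʳ-≤ Y (m≤m+n 1 s) ⟩ Y + (1 + s) ∎) ,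
    (begin Y ≤⟨ n≤1+n Y ⟩ suc Y ≡⟨ Y≡ ⟩ q′ * K + s ≤⟨ +-monoʳ-≤ (q′ * K) (n≤1+n s) ⟩ q′ * K + (1 + s) ∎)
  errors≤ : (q′ * b + s + s) * (q * K) + (0 + (q * b * (q′ * K) + P * (1 + s))) ≤ q * K * (1 + 2 * (q′ * b) + 3 * s)
  errors≤ = begin
    (q′ * b + s + s) * (q * K) + (0 + (q * b * (q′ * K) + P * (1 + s)))
      ≤⟨ +-monoʳ-≤ ((q′ * b + s + s) * (q * K)) (+-monoʳ-≤ (q * b * (q′ * K)) (*-monoˡ-≤ (1 + s) P≤qK)) ⟩
    (q′ * b + s + s) * (q * K) + (0 + (q * b * (q′ * K) + q * K * (1 + s)))
      ≡⟨ solve 5 (λ q′ b s q K → (q′ :* b :+ s :+ s) :* (q :* K) :+ (con 0 :+ (q :* b :* (q′ :* K) :+ q :* K :* (con 1 :+ s)))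
                              := q :* K :* (con 1 :+ con 2 :* (q′ :* b) :+ con 3 :* s)) refl q′ b s q K ⟩
    q * K * (1 + 2 * (q′ * b) + 3 * s) ∎

error-small : ∀ Y K q′ s b Q T → b * T ≤ K → 4 * Q ≤ T → suc Y ≡ q′ * K + s → s ≤ K → 1 ≤ K →
  8 * K * Q + 2 ≤ Y → (1 + 2 * (q′ * b) + 3 * s) * Q < Y
error-small Y K q′ s b Q T bT≤K 4Q≤T Y≡ s≤K 1≤K Y-large = *-cancelˡ-< 4 _ _ (begin-strict
  4 * ((1 + 2 * (q′ * b) + 3 * s) * Q)
    ≡⟨ solve 4 (λ q′ b s Q → con 4 :* ((con 1 :+ con 2 :* (q′ :* b) :+ con 3 :* s) :* Q)
                          := con 4 :* Q :+ con 2 :* (q′ :* b) :* (con 4 :* Q) :+ con 12 :* s :* Q) refl q′ b s Q ⟩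
  4 * Q + 2 * (q′ * b) * (4 * Q) + 12 * s * Q
    ≤⟨ +-mono-≤ (+-mono-≤ (*-monoʳ-≤ 4 (m≤n*m Q K {{ℕ.>-nonZero 1≤K}})) (*-monoʳ-≤ (2 * (q′ * b)) 4Q≤T))
                (*-monoˡ-≤ Q (*-monoʳ-≤ 12 s≤K)) ⟩
  4 * (K * Q) + 2 * (q′ * b) * T + 12 * K * Q
    ≡⟨ cong (λ z → 4 * (K * Q) + z + 12 * K * Q)
            (solve 3 (λ q′ b T → con 2 :* (q′ :* b) :* T := con 2 :* (q′ :* (b :* T))) refl q′ b T) ⟩
  4 * (K * Q) + 2 * (q′ * (b * T)) + 12 * K * Q
    ≤⟨ +-monoˡ-≤ (12 * K * Q) (+-monoʳ-≤ (4 * (K * Q)) (*-monoʳ-≤ 2 periods≤Y+1)) ⟩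
  4 * (K * Q) + 2 * suc Y + 12 * K * Q
    ≡⟨ solve 3 (λ K Q Y → con 4 :* (K :* Q) :+ con 2 :* (con 1 :+ Y) :+ con 12 :* K :* Q
                       := con 2 :* (con 8 :* K :* Q :+ con 1) :+ con 2 :* Y) refl K Q Y ⟩
  2 * (8 * K * Q + 1) + 2 * Y
    <⟨ +-monoˡ-< (2 * Y) (*-monoʳ-< 2 (≤-trans (≤-reflexive (sym (+-suc (8 * K * Q) 1))) Y-large)) ⟩
  2 * Y + 2 * Y
    ≡⟨ solve 1 (λ Y → con 2 :* Y :+ con 2 :* Y := con 4 :* Y) refl Y ⟩
  4 * Y ∎)
  where
  open ≤-Reasoning
  periods≤Y+1 : q′ * (b * T) ≤ suc Y
  periods≤Y+1 = ≤-trans (*-monoʳ-≤ q′ bT≤K) (≤-trans (m≤m+n (q′ * K) s) (≤-reflexive (sym Y≡)))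

frac-close : ∀ X m P z e (ε : ℚ) → 0ℚ ℚ.< ε →
  X * suc z ≈[ suc z * e ] P * suc m → e * ℚ.↧ₙ ε < suc m →
  ℚ.∣ frac X m ℚ.- frac P z ∣ ℚ.< ε
frac-close X m P z e (mkℚ (ℤ.+ 0) q _) ε>0 _ _ with ℚP.drop-*<* ε>0
... | ℤ.+<+ ()
frac-close X m P z e (mkℚ ℤ.-[1+ _ ] q _) ε>0 _ _ with ℚP.drop-*<* ε>0
... | ()
frac-close X m P z e ε@(mkℚ (ℤ.+ suc p) q _) _ cross small =
  ℚP.toℚᵘ-cancel-< (ℚᵘP.<-respˡ-≃ (ℚᵘP.≃-sym as-unnormalised)
    (*<* (subst₂ ℤ._<_ (ℤP.pos-* ℤ.∣ num ∣ (suc q)) (ℤP.pos-* (suc p) (suc m * suc z)) (ℤ.+<+ num<))))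
  where
  num : ℤ
  num = ℤ.+ X ℤ.* ℤ.+ suc z ℤ.+ (ℤ.- ℤ.+ P) ℤ.* ℤ.+ suc m
  num≡ : num ≡ (X * suc z) ⊖ (P * suc m)
  num≡ = trans (cong₂ ℤ._+_ (sym (ℤP.pos-* X (suc z)))
                            (trans (sym (ℤP.neg-distribˡ-* (ℤ.+ P) (ℤ.+ suc m))) (cong ℤ.-_ (sym (ℤP.pos-* P (suc m))))))
               (ℤP.m-n≡m⊖n (X * suc z) (P * suc m))
  as-unnormalised : toℚᵘ (ℚ.∣ frac X m ℚ.- frac P z ∣) ℚᵘ.≃ ℚᵘ.∣ mkℚᵘ (ℤ.+ X) m ℚᵘ.- mkℚᵘ (ℤ.+ P) z ∣
  as-unnormalised = ℚᵘP.≃-trans (ℚP.toℚᵘ-homo-∣-∣ (frac X m ℚ.- frac P z))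
    (ℚᵘP.∣-∣-cong (ℚᵘP.≃-trans (ℚP.toℚᵘ-homo-+ (frac X m) (ℚ.- frac P z))
      (ℚᵘP.+-cong (frac-toℚᵘ X m) (ℚᵘP.≃-trans (ℚP.toℚᵘ-homo‿- (frac P z)) (ℚᵘP.-‿cong (frac-toℚᵘ P z))))))
  open ≤-Reasoning
  num< : ℤ.∣ num ∣ * suc q < suc p * (suc m * suc z)
  num< = begin-strict
    ℤ.∣ num ∣ * suc q       ≤⟨ *-monoˡ-≤ (suc q) (subst (λ w → ℤ.∣ w ∣ ≤ suc z * e) (sym num≡) (∣⊖∣≤ cross)) ⟩
    suc z * e * suc q       ≡⟨ *-assoc (suc z) e (suc q) ⟩
    suc z * (e * suc q)     <⟨ *-monoʳ-< (suc z) small ⟩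
    suc z * suc m           ≡⟨ *-comm (suc z) (suc m) ⟩
    suc m * suc z           ≤⟨ m≤n*m (suc m * suc z) (suc p) ⟩
    suc p * (suc m * suc z) ∎

density-vs-product : ∀ a d k (ε : ℚ) → 0ℚ ℚ.< ε → a < 2 ^ k → ∀ m n q′ s →
  k ≤ suc n → suc (suc m) ≡ q′ * 2 ^ k + s →
  (1 + 2 * (q′ * carryCount a k) + 3 * s) * ℚ.↧ₙ ε < suc m →
  ℚ.∣ density a d m ℚ.- prodSeq a n d ∣ ℚ.< ε
density-vs-product a d k ε ε>0 a<2ᵏ m n q′ s k≤n+1 N≡ small =
  subst (λ w → ℚ.∣ density a d m ℚ.- w ∣ ℚ.< ε) (sym prodSeq≡)
        (frac-close (count a d (suc m)) m P (pred2^ (k + j)) e ε ε>0 cross small)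
  where
  j = suc n ∸ k
  e = 1 + 2 * (q′ * carryCount a k) + 3 * s
  P = stateTotal a (k + j) d
  prodSeq≡ : prodSeq a n d ≡ frac P (pred2^ (k + j))
  prodSeq≡ = trans (prodSeq-counts a n d)
                   (cong (λ l → frac (stateTotal a l d) (pred2^ l)) (sym (m+[n∸m]≡n k≤n+1)))
  levels : 2 ^ j * 2 ^ k ≡ 2 ^ (k + j)
  levels = trans (*-comm (2 ^ j) (2 ^ k)) (sym (^-distribˡ-+-* 2 k j))
  cross : count a d (suc m) * suc (pred2^ (k + j)) ≈[ suc (pred2^ (k + j)) * e ] P * suc m
  cross = ≈-resp (cong (count a d (suc m) *_) denominator) (cong (_* e) denominator) refl
                 (cross-approx (count a d (suc m)) P (suc m) (2 ^ j) (2 ^ k) q′ s (stateCount a k d 0) (carryCount a k) N≡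
                               (subst (P ≤_) (sym levels) (stateTotal≤ a (k + j) d))
                               (count-approx a d k m q′ s a<2ᵏ N≡) (stateTotal-approx a d k j a<2ᵏ))
    where
    denominator : 2 ^ j * 2 ^ k ≡ suc (pred2^ (k + j))
    denominator = trans levels (sym (suc-pred2^ (k + j)))

divide : ∀ N k → ∃[ q ] ∃[ s ] (N ≡ q * 2 ^ k + s × s < 2 ^ k)
divide N k = N / 2 ^ k , N % 2 ^ k , trans (m≡m%n+[m/n]*n N (2 ^ k)) (+-comm (N % 2 ^ k) _) , m%n<n N (2 ^ k)
  where
  instance
    2ᵏ≢0 : ℕ.NonZero (2 ^ k)
    2ᵏ≢0 = m^n≢0 2 k

-- μ_a(d) is the limit of the product sequence: with Q the denominator of ε, work at
-- level k = a + Q + 2, where carries have proportion at most 1/(4Q), and take m, n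
-- beyond 8 · 2^k · Q + 2 + k
theorem1 : (a : ℕ) (d : ℤ) (ε : ℚ) → 0ℚ ℚ.< ε →
    ∃[ M ] ((m n : ℕ) → M ≤ m → M ≤ n →
    ℚ.∣ density a d m ℚ.- prodSeq a n d ∣ ℚ.< ε)
theorem1 a d ε ε>0 = M , close
  where
  Q = ℚ.↧ₙ ε
  t = 2 + Q
  k = a + t
  M = 8 * 2 ^ k * Q + 2 + k
  a<2ᵏ : a < 2 ^ k
  a<2ᵏ = <-≤-trans (n<2^n a) (^-monoʳ-≤ 2 (m≤m+n a t))
  rare-carries : carryCount a k * 2 ^ t ≤ 2 ^ k
  rare-carries = ≤-trans (*-monoˡ-≤ (2 ^ t) (carryCount-bound a a t (n<2^n a))) (≤-reflexive (sym (^-distribˡ-+-* 2 a t)))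
  4Q≤2ᵗ : 4 * Q ≤ 2 ^ t
  4Q≤2ᵗ = ≤-trans (*-monoʳ-≤ 4 (<⇒≤ (n<2^n Q))) (≤-reflexive (*-assoc 2 2 (2 ^ Q)))
  close : (m n : ℕ) → M ≤ m → M ≤ n → ℚ.∣ density a d m ℚ.- prodSeq a n d ∣ ℚ.< ε
  close m n M≤m M≤n with divide (suc (suc m)) k
  ... | q′ , s , N≡ , s<2ᵏ =
    density-vs-product a d k ε ε>0 a<2ᵏ m n q′ s
      (≤-trans (m≤n+m k (8 * 2 ^ k * Q + 2)) (≤-trans M≤n (n≤1+n n))) N≡
      (error-small (suc m) (2 ^ k) q′ s (carryCount a k) Q (2 ^ t) rare-carries 4Q≤2ᵗ N≡ (<⇒≤ s<2ᵏ) (m^n>0 2 k)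
                   (≤-trans (m≤m+n (8 * 2 ^ k * Q + 2) k) (≤-trans M≤m (n≤1+n m))))
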